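{- For every $n$ and every $\alpha\in(0,1]$, $\mathrm{pd}_\alpha(C_n)=\mathrm{pd}_\alpha(P_n)=\left\lceil \frac{n\alpha}{3}\right\rceil$, where $C_n$ is the cycle and $P_n$ the path on $n$ vertices.
   Context: All graphs are finite and simple. For a graph $G=(V,E)$ and $S\subseteq V$, $N[S]$ denotes the closed neighbourhood of $S$. For $0<\alpha\le 1$, a set $S\subseteq V$ is an $\alpha$-partial dominating set if $|N[S]|\ge \alpha|V|$; $\mathrm{pd}_\alpha(G)$ is the minimum size of an $\alpha$-partial dominating set.
   Formalization: The parameter α ranges over the rationals in $(0,1]$. -}

module Defs where

open import Data.Nat using (ℕ; zero; suc; _≡ᵇ_; _≤_)
open import Data.Bool using (Bool; true; false; _∨_; _∧_)
open import Data.Fin using (Fin; toℕ)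
open import Data.Fin.Subset using (Subset; ∣_∣)
open import Data.Vec using (lookup; tabulate)
open import Data.Integer using (+_)
open import Data.Rational using (ℚ; _/_; _*_) renaming (_≤_ to _≤ℚ_)
open import Data.Product using (Σ; _×_)
open import Relation.Binary.PropositionalEquality using (_≡_)

-- A (finite, simple) graph on the vertex set Fin n, given by a Boolean
-- adjacency relation (symmetric and irreflexive for the graphs below).
Graph : ℕ → Set
Graph n = Fin n → Fin n → Bool

anyFin : ∀ {n} → (Fin n → Bool) → Bool
anyFin {zero}  f = false
anyFin {suc n} f = f Fin.zero ∨ anyFin (λ i → f (Fin.suc i))

N[_]_ : ∀ {n} → Subset n → Graph n → Subset n
N[_]_ {n} S G = tabulate λ v → lookup S v ∨ anyFin (λ u → lookup S u ∧ G u v)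

IsPartialDom : ∀ {n} → Graph n → ℚ → Subset n → Set
IsPartialDom {n} G α S = α * (+ n / 1) ≤ℚ (+ ∣ N[ S ] G ∣ / 1)

IsPd : ∀ {n} → Graph n → ℚ → ℕ → Set
IsPd {n} G α k =
  Σ (Subset n) (λ S → IsPartialDom G α S × ∣ S ∣ ≡ k)
  × (∀ (S : Subset n) → IsPartialDom G α S → k ≤ ∣ S ∣)

pathGraph : (n : ℕ) → Graph n
pathGraph n u v = (suc (toℕ u) ≡ᵇ toℕ v) ∨ (suc (toℕ v) ≡ᵇ toℕ u)

-- The cycle C_n : the path plus the edge {0, n-1} (used for n ≥ 3).
cycleGraph : (n : ℕ) → Graph n
cycleGraph n u v = pathGraph n u v
  ∨ ((toℕ u ≡ᵇ 0) ∧ (suc (toℕ v) ≡ᵇ n))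
  ∨ ((toℕ v ≡ᵇ 0) ∧ (suc (toℕ u) ≡ᵇ n))

module Submission where

-- Both values are obtained at once for every graph G with P_n ⊆ G ⊆ C_n
-- (module Bounds); write k = ⌈αn/3⌉.
--
-- In a subgraph of C_n a vertex dominates at
-- most three vertices (itself and its cyclic successor and predecessor), so
-- by a union bound |N[S]| ≤ 3|S| for every S.  Conversely, on P_n the
-- pattern ∘•∘ ∘•∘ … gives, for every k ≤ n, a set of exactly k vertices
-- dominating at least min(3k, n) vertices, and adding edges only enlarges N[S].
--
-- With α = a/D in lowest terms, αn/3 is the fraction an/(3D),
-- whose ceiling k is the least natural with an ≤ 3kD, and |N[S]| ≥ αn reads
-- an ≤ |N[S]|·D.  Hence (using a ≤ D) an α-dominating S has 3|S| ≥ αn and so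
-- |S| ≥ k, while dominating min(3k, n) vertices suffices.

open import Defs

module Arithmetic where
  open import Data.Nat as ℕ using (ℕ; zero; suc; _*_; _⊓_; _≤_; z≤n)
  import Data.Nat.Properties as ℕ
  open import Data.Nat.Coprimality using (Coprime)
  open import Data.Integer as ℤ using (ℤ; +_; -[1+_]; +[1+_]; -_; ∣_∣; +≤+)
  import Data.Integer.Properties as ℤ
  open import Data.Integer.DivMod using ([n/ℕd]*d≤n; n<s[n/ℕd]*d; div-pos-is-/ℕ)
  open import Data.Rational using (ℚ; mkℚ; ↥_; ↧ₙ_; 1ℚ; _/_; ceiling; toℚᵘ; *≤*)
    renaming (_≤_ to _≤ℚ_; _*_ to _*ℚ_)
  import Data.Rational.Properties as ℚ
  open import Data.Rational.Unnormalised as ℚᵘ using (mkℚᵘ)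
    renaming (_≤_ to _≤ᵘ_; _≃_ to _≃ᵘ_)
  import Data.Rational.Unnormalised.Properties as ℚᵘ
  open import Relation.Binary.PropositionalEquality

  ceilDiv : ℤ → (D : ℕ) .{{_ : ℕ.NonZero D}} → ℤ
  ceilDiv m D = - ((- m) ℤ./ℕ D)

  ceilDiv-upper : ∀ m D .{{_ : ℕ.NonZero D}} → m ℤ.≤ ceilDiv m D ℤ.* + D
  ceilDiv-upper m D = begin
    m                               ≡⟨ ℤ.neg-involutive m ⟨
    - (- m)                         ≤⟨ ℤ.neg-mono-≤ ([n/ℕd]*d≤n (- m) D) ⟩
    - ((- m) ℤ./ℕ D ℤ.* + D)        ≡⟨ ℤ.neg-distribˡ-* ((- m) ℤ./ℕ D) (+ D) ⟩
    ceilDiv m D ℤ.* + D             ∎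
    where open ℤ.≤-Reasoning

  ceilDiv-least : ∀ m D .{{_ : ℕ.NonZero D}} z → m ℤ.≤ z ℤ.* + D → ceilDiv m D ℤ.≤ z
  ceilDiv-least m D z m≤zD =
    subst (- q ℤ.≤_) (ℤ.neg-involutive z) (ℤ.neg-mono-≤ -z≤q)
    where
    open ℤ.≤-Reasoning
    q = (- m) ℤ./ℕ D
    -zD<[q+1]D : (- z) ℤ.* + D ℤ.< ℤ.suc q ℤ.* + D
    -zD<[q+1]D = begin-strict
      (- z) ℤ.* + D   ≡⟨ ℤ.neg-distribˡ-* z (+ D) ⟨
      - (z ℤ.* + D)   ≤⟨ ℤ.neg-mono-≤ m≤zD ⟩
      - m             <⟨ n<s[n/ℕd]*d (- m) D ⟩
      ℤ.suc q ℤ.* + D ∎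
    -z≤q : - z ℤ.≤ q
    -z≤q = subst (- z ℤ.≤_) (ℤ.pred-suc q)
      (ℤ.i<j⇒i≤pred[j] {j = ℤ.suc q} (ℤ.*-cancelʳ-<-nonNeg (+ D) -zD<[q+1]D))

  ceiling≡ceilDiv : ∀ q → ceiling q ≡ ceilDiv (↥ q) (↧ₙ q)
  ceiling≡ceilDiv (mkℚ (+ zero) e _) = cong -_ (div-pos-is-/ℕ (+ 0) (suc e))
  ceiling≡ceilDiv (mkℚ +[1+ n ] e _) = cong -_ (div-pos-is-/ℕ -[1+ n ] (suc e))
  ceiling≡ceilDiv (mkℚ -[1+ n ] e _) = cong -_ (div-pos-is-/ℕ +[1+ n ] (suc e))

  ceiling-upper : ∀ q → toℚᵘ q ≤ᵘ mkℚᵘ (ceiling q) 0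
  ceiling-upper q@(mkℚ m e _) = ℚᵘ.*≤* (subst₂ ℤ._≤_ (sym (ℤ.*-identityʳ m))
    (cong (ℤ._* + suc e) (sym (ceiling≡ceilDiv q))) (ceilDiv-upper m (suc e)))

  ceiling-least : ∀ q z → toℚᵘ q ≤ᵘ mkℚᵘ z 0 → ceiling q ℤ.≤ z
  ceiling-least q@(mkℚ m e _) z (ℚᵘ.*≤* m≤zD) = subst (ℤ._≤ z) (sym (ceiling≡ceilDiv q))
    (ceilDiv-least m (suc e) z (subst (ℤ._≤ z ℤ.* + suc e) (ℤ.*-identityʳ m) m≤zD))

  IsFraction : ℚ → ℕ → (M : ℕ) .{{_ : ℕ.NonZero M}} → Set
  IsFraction q p M = toℚᵘ q ≃ᵘ (+ p ℚᵘ./ M)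

  fraction-≤-integer : ∀ {q p M z} .{{_ : ℕ.NonZero M}} → IsFraction q p M →
                       toℚᵘ q ≤ᵘ mkℚᵘ z 0 → + p ℤ.≤ z ℤ.* + M
  fraction-≤-integer {p = p} {M = M@(suc _)} {z} q≈p/M q≤z with ℚᵘ.≤-respˡ-≃ q≈p/M q≤z
  ... | ℚᵘ.*≤* p≤zM = subst (ℤ._≤ z ℤ.* + M) (ℤ.*-identityʳ (+ p)) p≤zM

  fraction-≤-integer⁻ : ∀ {q p M z} .{{_ : ℕ.NonZero M}} → IsFraction q p M →
                        + p ℤ.≤ z ℤ.* + M → toℚᵘ q ≤ᵘ mkℚᵘ z 0
  fraction-≤-integer⁻ {p = p} {M = M@(suc _)} {z} q≈p/M p≤zM = ℚᵘ.≤-respˡ-≃ (ℚᵘ.≃-sym q≈p/M)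
    (ℚᵘ.*≤* (subst (ℤ._≤ z ℤ.* + M) (sym (ℤ.*-identityʳ (+ p))) p≤zM))

  ceiling-fraction-nonneg : ∀ {q p M} .{{_ : ℕ.NonZero M}} → IsFraction q p M →
                            + ∣ ceiling q ∣ ≡ ceiling q
  ceiling-fraction-nonneg {q} {p} {M@(suc _)} q≈p/M = ℤ.0≤i⇒+∣i∣≡i
    (ℤ.*-cancelʳ-≤-pos (+ 0) (ceiling q) (+ M)
      (ℤ.≤-trans (+≤+ z≤n) (fraction-≤-integer q≈p/M (ceiling-upper q))))

  ceiling-fraction-upper : ∀ {q p M} .{{_ : ℕ.NonZero M}} → IsFraction q p M →
                           p ≤ ∣ ceiling q ∣ * M
  ceiling-fraction-upper {q} {p} {M} q≈p/M = ℤ.drop‿+≤+ (begin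
    + p                              ≤⟨ fraction-≤-integer q≈p/M (ceiling-upper q) ⟩
    ceiling q ℤ.* + M                ≡⟨ cong (ℤ._* + M) (ceiling-fraction-nonneg q≈p/M) ⟨
    + ∣ ceiling q ∣ ℤ.* + M          ≡⟨ ℤ.pos-* ∣ ceiling q ∣ M ⟨
    + (∣ ceiling q ∣ * M)            ∎)
    where open ℤ.≤-Reasoning

  ceiling-fraction-least : ∀ {q p M} .{{_ : ℕ.NonZero M}} → IsFraction q p M →
                           ∀ s → p ≤ s * M → ∣ ceiling q ∣ ≤ s
  ceiling-fraction-least {q} {p} {M} q≈p/M s p≤sM = ℤ.drop‿+≤+
    (subst (ℤ._≤ + s) (sym (ceiling-fraction-nonneg q≈p/M))
      (ceiling-least q (+ s) (fraction-≤-integer⁻ q≈p/M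
        (subst (+ p ℤ.≤_) (ℤ.pos-* s M) (+≤+ p≤sM)))))

  toℚᵘ-nat : ∀ c → toℚᵘ (+ c / 1) ≃ᵘ mkℚᵘ (+ c) 0
  toℚᵘ-nat c = ℚ.toℚᵘ-fromℚᵘ (mkℚᵘ (+ c) 0)

  fraction-≤-nat : ∀ {q p M} .{{_ : ℕ.NonZero M}} → IsFraction q p M →
                   ∀ c → q ≤ℚ (+ c / 1) → p ≤ c * M
  fraction-≤-nat {M = M} q≈p/M c q≤c = ℤ.drop‿+≤+ (subst (ℤ._≤_ _) (sym (ℤ.pos-* c M))
    (fraction-≤-integer q≈p/M (ℚᵘ.≤-respʳ-≃ (toℚᵘ-nat c) (ℚ.toℚᵘ-mono-≤ q≤c))))

  fraction-≤-nat⁻ : ∀ {q p M} .{{_ : ℕ.NonZero M}} → IsFraction q p M →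
                    ∀ c → p ≤ c * M → q ≤ℚ (+ c / 1)
  fraction-≤-nat⁻ {p = p} {M} q≈p/M c p≤cM = ℚ.toℚᵘ-cancel-≤
    (ℚᵘ.≤-respʳ-≃ (ℚᵘ.≃-sym (toℚᵘ-nat c))
      (fraction-≤-integer⁻ q≈p/M (subst (+ p ℤ.≤_) (ℤ.pos-* c M) (+≤+ p≤cM))))

  scaled-fraction : ∀ a e .(cop : Coprime a (suc e)) n d →
    IsFraction (mkℚ (+ a) e cop *ℚ (+ n / suc d)) (a * n) (suc e * suc d)
  scaled-fraction a e cop n d = begin
    toℚᵘ (mkℚ (+ a) e cop *ℚ (+ n / suc d))        ≈⟨ ℚ.toℚᵘ-homo-* (mkℚ (+ a) e cop) (+ n / suc d) ⟩
    mkℚᵘ (+ a) e ℚᵘ.* toℚᵘ (+ n / suc d)           ≈⟨ ℚᵘ.*-congˡ {mkℚᵘ (+ a) e} (ℚ.toℚᵘ-fromℚᵘ (mkℚᵘ (+ n) d)) ⟩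
    mkℚᵘ (+ a) e ℚᵘ.* mkℚᵘ (+ n) d                 ≡⟨ cong (ℚᵘ._/ (suc e * suc d)) (ℤ.pos-* a n) ⟨
    + (a * n) ℚᵘ./ (suc e * suc d)                 ∎
    where open ℚᵘ.≃-Reasoning

  numerator-≤-denominator : ∀ {a e} .{cop : Coprime a (suc e)} → mkℚ (+ a) e cop ≤ℚ 1ℚ → a ≤ suc e
  numerator-≤-denominator {a} {e} (*≤* a≤D) =
    ℤ.drop‿+≤+ (subst₂ ℤ._≤_ (ℤ.*-identityʳ (+ a)) (ℤ.*-identityˡ (+ suc e)) a≤D)

  *-rearrange : ∀ k D → k * (D * 3) ≡ 3 * k * D
  *-rearrange k D = begin
    k * (D * 3)  ≡⟨ cong (k *_) (ℕ.*-comm D 3) ⟩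
    k * (3 * D)  ≡⟨ ℕ.*-assoc k 3 D ⟨
    k * 3 * D    ≡⟨ cong (_* D) (ℕ.*-comm k 3) ⟩
    3 * k * D    ∎
    where open ≡-Reasoning

  -- The arithmetic of the bound: α = a/D with a ≤ D, and k is the least
  -- natural with an ≤ k·3D, i.e. k = ⌈αn/3⌉.
  module Threshold {n a D k : ℕ} (a≤D : a ≤ D)
                   (k-upper : a * n ≤ k * (D * 3))
                   (k-least : ∀ s → a * n ≤ s * (D * 3) → k ≤ s) where

    open ℕ.≤-Reasoning

    -- Since α ≤ 1, no more than n vertices are needed.
    k≤n : k ≤ n
    k≤n = k-least n (begin
      a * n        ≤⟨ ℕ.*-monoˡ-≤ n a≤D ⟩
      D * n        ≡⟨ ℕ.*-comm D n ⟩
      n * D        ≤⟨ ℕ.*-monoʳ-≤ n (ℕ.m≤m*n D 3) ⟩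
      n * (D * 3)  ∎)

    -- If c ≥ αn vertices are dominated by s vertices, each dominating at most
    -- three, then s ≥ k.
    lower : ∀ c s → a * n ≤ c * D → c ≤ 3 * s → k ≤ s
    lower c s an≤cD c≤3s = k-least s (begin
      a * n        ≤⟨ an≤cD ⟩
      c * D        ≤⟨ ℕ.*-monoˡ-≤ D c≤3s ⟩
      3 * s * D    ≡⟨ *-rearrange s D ⟨
      s * (D * 3)  ∎)

    -- Dominating min(3k, n) vertices is enough: αn ≤ 3k and αn ≤ n.
    enough : ∀ c → 3 * k ⊓ n ≤ c → a * n ≤ c * D
    enough c covers = begin
      a * n                ≤⟨ ℕ.⊓-glb an≤3kD an≤nD ⟩
      3 * k * D ⊓ (n * D)  ≡⟨ ℕ.*-distribʳ-⊓ D (3 * k) n ⟨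
      (3 * k ⊓ n) * D      ≤⟨ ℕ.*-monoˡ-≤ D covers ⟩
      c * D                ∎
      where
      an≤3kD : a * n ≤ 3 * k * D
      an≤3kD = ℕ.≤-trans k-upper (ℕ.≤-reflexive (*-rearrange k D))
      an≤nD : a * n ≤ n * D
      an≤nD = ℕ.≤-trans (ℕ.*-monoˡ-≤ n a≤D) (ℕ.≤-reflexive (ℕ.*-comm D n))

module Domination where
  open import Data.Bool using (Bool; T; _∨_; _∧_)
  open import Data.Bool.Properties using (T-≡; T-∨; T-∧)
  open import Data.Nat as ℕ using (zero; suc; _+_; _*_; _⊓_; _≤_; _<_; z≤n; s≤s)
  import Data.Nat.Properties as ℕ
  open import Data.Fin using (Fin; zero; suc; toℕ; fromℕ; fromℕ<; inject₁)
  open import Data.Fin.Properties using (toℕ-injective; toℕ<n; toℕ-fromℕ; toℕ-fromℕ<; toℕ-inject₁)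
  open import Data.Fin.Subset using (Subset; inside; outside; ⊥; ⁅_⁆; _∪_; _∈_; _⊆_)
    renaming (∣_∣ to ∣_∣ˢ)
  open import Data.Fin.Subset.Properties
    using (⊆-refl; s⊆s; out⊆; ∣⊥∣≡0; ∣⁅x⁆∣≡1; ∣p∣≤∣x∷p∣; p⊆q⇒∣p∣≤∣q∣; x∈⁅x⁆; x∈⁅y⁆⇒x≡y;
           p⊆p∪q; q⊆p∪q; x∈p∪q⁺)
  open import Data.Vec using ([]; _∷_; here; there; lookup)
  open import Data.Vec.Properties using (lookup∘tabulate; []=⇒lookup; lookup⇒[]=)
  open import Data.Product using (_×_; _,_; ∃)
  open import Data.Sum using (_⊎_; inj₁; inj₂)
  open import Data.Empty using (⊥-elim)
  open import Function using (_∘_; Equivalence)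
  open import Relation.Nullary using (yes; no)
  open import Relation.Binary.PropositionalEquality

  _⊆ᴳ_ : ∀ {n} → Graph n → Graph n → Set
  G ⊆ᴳ H = ∀ u v → T (G u v) → T (H u v)

  ⊆ᴳ-refl : ∀ {n} {G : Graph n} → G ⊆ᴳ G
  ⊆ᴳ-refl _ _ uv = uv

  path⊆cycle : ∀ {n} → pathGraph n ⊆ᴳ cycleGraph n
  path⊆cycle _ _ uv = Equivalence.from T-∨ (inj₁ uv)

  ∈⇒T : ∀ {n} {S : Subset n} {v} → v ∈ S → T (lookup S v)
  ∈⇒T v∈S = subst T (sym ([]=⇒lookup v∈S)) _

  T⇒∈ : ∀ {n} {S : Subset n} {v} → T (lookup S v) → v ∈ S
  T⇒∈ {S = S} {v} t = lookup⇒[]= v S (Equivalence.to T-≡ t)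

  anyFin-intro : ∀ {n} (f : Fin n → Bool) u → T (f u) → T (anyFin f)
  anyFin-intro f zero    t = Equivalence.from T-∨ (inj₁ t)
  anyFin-intro f (suc u) t = Equivalence.from T-∨ (inj₂ (anyFin-intro (f ∘ suc) u t))

  anyFin-elim : ∀ {n} (f : Fin n → Bool) → T (anyFin f) → ∃ λ u → T (f u)
  anyFin-elim {suc n} f t with Equivalence.to T-∨ t
  ... | inj₁ t₀ = zero , t₀
  ... | inj₂ t₊ with anyFin-elim (f ∘ suc) t₊
  ...   | u , tᵤ = suc u , tᵤ

  module _ {n} {S : Subset n} {G : Graph n} where

    private
      lookup-N : ∀ v → lookup (N[ S ] G) v ≡ (lookup S v ∨ anyFin (λ u → lookup S u ∧ G u v))
      lookup-N = lookup∘tabulate (λ w → lookup S w ∨ anyFin (λ u → lookup S u ∧ G u w))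

      N-intro : ∀ {v} → T (lookup S v) ⊎ T (anyFin (λ u → lookup S u ∧ G u v)) → v ∈ N[ S ] G
      N-intro {v} t = T⇒∈ (subst T (sym (lookup-N v)) (Equivalence.from T-∨ t))

    N-self : ∀ {v} → v ∈ S → v ∈ N[ S ] G
    N-self v∈S = N-intro (inj₁ (∈⇒T v∈S))

    N-nbr : ∀ {u v} → u ∈ S → T (G u v) → v ∈ N[ S ] G
    N-nbr {u} {v} u∈S uv = N-intro (inj₂ (anyFin-intro (λ w → lookup S w ∧ G w v) u
      (Equivalence.from T-∧ (∈⇒T u∈S , uv))))

    N-elim : ∀ {v} → v ∈ N[ S ] G → v ∈ S ⊎ ∃ λ u → u ∈ S × T (G u v)
    N-elim {v} v∈N with Equivalence.to T-∨ (subst T (lookup-N v) (∈⇒T v∈N))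
    ... | inj₁ t = inj₁ (T⇒∈ t)
    ... | inj₂ t with anyFin-elim (λ u → lookup S u ∧ G u v) t
    ...   | u , t′ with Equivalence.to T-∧ t′
    ...     | tᵤ , uv = inj₂ (u , T⇒∈ tᵤ , uv)

  N-mono : ∀ {n} {S S′ : Subset n} {G H : Graph n} → S ⊆ S′ → G ⊆ᴳ H → N[ S ] G ⊆ N[ S′ ] H
  N-mono {S = S} {S′} {G} {H} S⊆S′ G⊆H {v} v∈N with N-elim {S = S} {G} v∈N
  ... | inj₁ v∈S            = N-self {S = S′} {H} (S⊆S′ v∈S)
  ... | inj₂ (u , u∈S , uv) = N-nbr {S = S′} {H} (S⊆S′ u∈S) (G⊆H u v uv)

  ∣p∪q∣≤∣p∣+∣q∣ : ∀ {n} (p q : Subset n) → ∣ p ∪ q ∣ˢ ≤ ∣ p ∣ˢ + ∣ q ∣ˢ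
  ∣p∪q∣≤∣p∣+∣q∣ []            []        = z≤n
  ∣p∪q∣≤∣p∣+∣q∣ (inside ∷ p)  (s ∷ q)   = s≤s (ℕ.≤-trans (∣p∪q∣≤∣p∣+∣q∣ p q)
    (ℕ.+-monoʳ-≤ ∣ p ∣ˢ (∣p∣≤∣x∷p∣ s q)))
  ∣p∪q∣≤∣p∣+∣q∣ (outside ∷ p) (inside ∷ q)  = ℕ.≤-trans (s≤s (∣p∪q∣≤∣p∣+∣q∣ p q))
    (ℕ.≤-reflexive (sym (ℕ.+-suc ∣ p ∣ˢ ∣ q ∣ˢ)))
  ∣p∪q∣≤∣p∣+∣q∣ (outside ∷ p) (outside ∷ q) = ∣p∪q∣≤∣p∣+∣q∣ p q

  ⋃[_]_ : ∀ {n m} → Subset n → (Fin n → Subset m) → Subset m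
  ⋃[ [] ]          A = ⊥
  ⋃[ outside ∷ S ] A = ⋃[ S ] (A ∘ suc)
  ⋃[ inside ∷ S ]  A = A zero ∪ ⋃[ S ] (A ∘ suc)

  ∈⋃ : ∀ {n m} {S : Subset n} {A : Fin n → Subset m} {u x} → u ∈ S → x ∈ A u → x ∈ ⋃[ S ] A
  ∈⋃ {S = inside ∷ S}  here        x∈Au = p⊆p∪q _ x∈Au
  ∈⋃ {S = inside ∷ S}  (there u∈S) x∈Au = q⊆p∪q _ _ (∈⋃ u∈S x∈Au)
  ∈⋃ {S = outside ∷ S} (there u∈S) x∈Au = ∈⋃ u∈S x∈Au

  ∣⋃∣≤ : ∀ {n m} c (S : Subset n) (A : Fin n → Subset m) → (∀ u → ∣ A u ∣ˢ ≤ c) →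
         ∣ ⋃[ S ] A ∣ˢ ≤ c * ∣ S ∣ˢ
  ∣⋃∣≤ {m = m} c [] A ∣A∣≤c = ℕ.≤-trans (ℕ.≤-reflexive (∣⊥∣≡0 m)) z≤n
  ∣⋃∣≤ c (outside ∷ S) A ∣A∣≤c = ∣⋃∣≤ c S (A ∘ suc) (∣A∣≤c ∘ suc)
  ∣⋃∣≤ c (inside ∷ S)  A ∣A∣≤c = begin
    ∣ A zero ∪ ⋃[ S ] (A ∘ suc) ∣ˢ          ≤⟨ ∣p∪q∣≤∣p∣+∣q∣ (A zero) (⋃[ S ] (A ∘ suc)) ⟩
    ∣ A zero ∣ˢ + ∣ ⋃[ S ] (A ∘ suc) ∣ˢ     ≤⟨ ℕ.+-mono-≤ (∣A∣≤c zero) (∣⋃∣≤ c S (A ∘ suc) (∣A∣≤c ∘ suc)) ⟩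
    c + c * ∣ S ∣ˢ                          ≡⟨ ℕ.*-suc c ∣ S ∣ˢ ⟨
    c * suc ∣ S ∣ˢ                          ∎
    where open ℕ.≤-Reasoning

  ≡ᵇ-pair : ∀ a b c d → T ((a ℕ.≡ᵇ b) ∧ (c ℕ.≡ᵇ d)) → a ≡ b × c ≡ d
  ≡ᵇ-pair a b c d t with Equivalence.to T-∧ t
  ... | t₁ , t₂ = ℕ.≡ᵇ⇒≡ a b t₁ , ℕ.≡ᵇ⇒≡ c d t₂

  cycle-edge : ∀ {n} {u v : Fin n} → T (cycleGraph n u v) →
    suc (toℕ u) ≡ toℕ v ⊎ suc (toℕ v) ≡ toℕ u ⊎
    (toℕ u ≡ 0 × suc (toℕ v) ≡ n) ⊎ (toℕ v ≡ 0 × suc (toℕ u) ≡ n)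
  cycle-edge {n} {u} {v} uv with Equivalence.to T-∨ uv
  ... | inj₁ path with Equivalence.to T-∨ path
  ...   | inj₁ e = inj₁ (ℕ.≡ᵇ⇒≡ (suc (toℕ u)) (toℕ v) e)
  ...   | inj₂ e = inj₂ (inj₁ (ℕ.≡ᵇ⇒≡ (suc (toℕ v)) (toℕ u) e))
  cycle-edge {n} {u} {v} uv | inj₂ wrap with Equivalence.to T-∨ wrap
  ...   | inj₁ w = inj₂ (inj₂ (inj₁ (≡ᵇ-pair (toℕ u) 0 (suc (toℕ v)) n w)))
  ...   | inj₂ w = inj₂ (inj₂ (inj₂ (≡ᵇ-pair (toℕ v) 0 (suc (toℕ u)) n w)))

  next : ∀ {m} → Fin (suc m) → Fin (suc m)
  next {m} i with suc (toℕ i) ℕ.<? suc m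
  ... | yes i+1<n = fromℕ< i+1<n
  ... | no  _     = zero

  prev : ∀ {m} → Fin (suc m) → Fin (suc m)
  prev zero    = fromℕ _
  prev (suc i) = inject₁ i

  next-suc : ∀ {m} (u v : Fin (suc m)) → suc (toℕ u) ≡ toℕ v → v ≡ next u
  next-suc {m} u v e with suc (toℕ u) ℕ.<? suc m
  ... | yes u+1<n = toℕ-injective (trans (sym e) (sym (toℕ-fromℕ< u+1<n)))
  ... | no  u+1≮n = ⊥-elim (u+1≮n (subst (_< suc m) (sym e) (toℕ<n v)))

  next-last : ∀ {m} (u v : Fin (suc m)) → toℕ v ≡ 0 → suc (toℕ u) ≡ suc m → v ≡ next u
  next-last {m} u v v≡0 u+1≡n with suc (toℕ u) ℕ.<? suc m
  ... | yes u+1<n = ⊥-elim (ℕ.<-irrefl u+1≡n u+1<n)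
  ... | no  _     = toℕ-injective v≡0

  prev-suc : ∀ {m} (u v : Fin (suc m)) → suc (toℕ v) ≡ toℕ u → v ≡ prev u
  prev-suc (suc i) v e = toℕ-injective (trans (ℕ.suc-injective e) (sym (toℕ-inject₁ i)))

  prev-first : ∀ {m} (u v : Fin (suc m)) → toℕ u ≡ 0 → suc (toℕ v) ≡ suc m → v ≡ prev u
  prev-first {m} zero v _ v+1≡n = toℕ-injective (trans (ℕ.suc-injective v+1≡n) (sym (toℕ-fromℕ m)))

  cycle-nbr : ∀ {m} {u v : Fin (suc m)} → T (cycleGraph (suc m) u v) → v ≡ next u ⊎ v ≡ prev u
  cycle-nbr {u = u} {v} uv with cycle-edge uv
  ... | inj₁ e                        = inj₁ (next-suc u v e)
  ... | inj₂ (inj₁ e)                 = inj₂ (prev-suc u v e)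
  ... | inj₂ (inj₂ (inj₁ (e₁ , e₂))) = inj₂ (prev-first u v e₁ e₂)
  ... | inj₂ (inj₂ (inj₂ (e₁ , e₂))) = inj₁ (next-last u v e₁ e₂)

  -- In a subgraph of the cycle, N[{u}] ⊆ {u, next u, prev u} has at most 3 vertices.
  ∣N⁅u⁆∣≤3 : ∀ {n} (G : Graph n) → G ⊆ᴳ cycleGraph n → ∀ u → ∣ N[ ⁅ u ⁆ ] G ∣ˢ ≤ 3
  ∣N⁅u⁆∣≤3 {suc m} G G⊆C u = begin
    ∣ N[ ⁅ u ⁆ ] G ∣ˢ                                  ≤⟨ p⊆q⇒∣p∣≤∣q∣ N⁅u⁆⊆ ⟩
    ∣ ⁅ u ⁆ ∪ ⁅ next u ⁆ ∪ ⁅ prev u ⁆ ∣ˢ              ≤⟨ ∣p∪q∣≤∣p∣+∣q∣ ⁅ u ⁆ _ ⟩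
    ∣ ⁅ u ⁆ ∣ˢ + ∣ ⁅ next u ⁆ ∪ ⁅ prev u ⁆ ∣ˢ         ≤⟨ ℕ.+-monoʳ-≤ ∣ ⁅ u ⁆ ∣ˢ (∣p∪q∣≤∣p∣+∣q∣ ⁅ next u ⁆ ⁅ prev u ⁆) ⟩
    ∣ ⁅ u ⁆ ∣ˢ + (∣ ⁅ next u ⁆ ∣ˢ + ∣ ⁅ prev u ⁆ ∣ˢ)  ≡⟨ cong₂ _+_ (∣⁅x⁆∣≡1 u) (cong₂ _+_ (∣⁅x⁆∣≡1 (next u)) (∣⁅x⁆∣≡1 (prev u))) ⟩
    3                                                  ∎
    where
    open ℕ.≤-Reasoning
    N⁅u⁆⊆ : N[ ⁅ u ⁆ ] G ⊆ ⁅ u ⁆ ∪ ⁅ next u ⁆ ∪ ⁅ prev u ⁆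
    N⁅u⁆⊆ {v} v∈N with N-elim {S = ⁅ u ⁆} {G} v∈N
    ... | inj₁ v∈⁅u⁆ = x∈p∪q⁺ (inj₁ v∈⁅u⁆)
    ... | inj₂ (w , w∈⁅u⁆ , wv) with x∈⁅y⁆⇒x≡y u w∈⁅u⁆
    ...   | refl with cycle-nbr {u = u} {v} (G⊆C u v wv)
    ...     | inj₁ refl = x∈p∪q⁺ (inj₂ (x∈p∪q⁺ (inj₁ (x∈⁅x⁆ _))))
    ...     | inj₂ refl = x∈p∪q⁺ (inj₂ (x∈p∪q⁺ (inj₂ (x∈⁅x⁆ _))))

  -- Upper bound: in a subgraph of the cycle, |N[S]| ≤ 3|S|, since N[S] is the
  -- union of the sets N[{u}], u ∈ S.
  ∣N∣≤3∣S∣ : ∀ {n} (G : Graph n) → G ⊆ᴳ cycleGraph n → ∀ S → ∣ N[ S ] G ∣ˢ ≤ 3 * ∣ S ∣ˢ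
  ∣N∣≤3∣S∣ G G⊆C S = ℕ.≤-trans (p⊆q⇒∣p∣≤∣q∣ N⊆⋃) (∣⋃∣≤ 3 S (λ u → N[ ⁅ u ⁆ ] G) (∣N⁅u⁆∣≤3 G G⊆C))
    where
    N⊆⋃ : N[ S ] G ⊆ ⋃[ S ] (λ u → N[ ⁅ u ⁆ ] G)
    N⊆⋃ v∈N with N-elim {S = S} {G} v∈N
    ... | inj₁ v∈S            = ∈⋃ {S = S} v∈S (N-self {G = G} (x∈⁅x⁆ _))
    ... | inj₂ (u , u∈S , uv) = ∈⋃ {S = S} u∈S (N-nbr {G = G} (x∈⁅x⁆ u) uv)

  extend : ∀ {n} (S : Subset n) k → ∣ S ∣ˢ ≤ k → k ≤ n → ∃ λ S′ → S ⊆ S′ × ∣ S′ ∣ˢ ≡ k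
  extend []            zero    _ _ = [] , ⊆-refl , refl
  extend (inside ∷ S)  (suc k) (s≤s ∣S∣≤k) (s≤s k≤n) with extend S k ∣S∣≤k k≤n
  ... | S′ , S⊆S′ , ∣S′∣≡k = inside ∷ S′ , s⊆s S⊆S′ , cong suc ∣S′∣≡k
  extend (outside ∷ S) zero    ∣S∣≤0 _ = outside ∷ S , ⊆-refl , ℕ.n≤0⇒n≡0 ∣S∣≤0
  extend (outside ∷ S) (suc k) ∣S∣≤1+k (s≤s k≤n) with ∣ S ∣ˢ ℕ.≤? k
  ... | no  ∣S∣≰k = outside ∷ S , ⊆-refl , ℕ.≤-antisym ∣S∣≤1+k (ℕ.≰⇒> ∣S∣≰k)
  ... | yes ∣S∣≤k with extend S k ∣S∣≤k k≤n
  ...   | S′ , S⊆S′ , ∣S′∣≡k = inside ∷ S′ , out⊆ S⊆S′ , cong suc ∣S′∣≡k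

  -- The pattern ∘•∘ ∘•∘ … on P_n (a single • at the start when at most two
  -- vertices remain) uses at most k vertices and dominates min(3k, n) of them.
  path-pattern : ∀ n k → ∃ λ S → ∣ S ∣ˢ ≤ k × 3 * k ⊓ n ≤ ∣ N[ S ] pathGraph n ∣ˢ
  path-pattern n       zero    = ⊥ , ℕ.≤-reflexive (∣⊥∣≡0 n) , z≤n
  path-pattern 0       (suc k) = [] , z≤n , z≤n
  path-pattern 1       (suc k) = inside ∷ [] , s≤s z≤n , ℕ.m⊓n≤n (3 * suc k) 1
  path-pattern 2       (suc k) = inside ∷ outside ∷ [] , s≤s z≤n , ℕ.m⊓n≤n (3 * suc k) 2
  path-pattern (suc (suc (suc m))) (suc k) with path-pattern m k
  ... | S , ∣S∣≤k , covers =
    outside ∷ inside ∷ outside ∷ S , s≤s ∣S∣≤k , (begin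
      3 * suc k ⊓ (3 + m)               ≡⟨ cong (_⊓ (3 + m)) (ℕ.*-suc 3 k) ⟩
      (3 + 3 * k) ⊓ (3 + m)             ≡⟨ ℕ.+-distribˡ-⊓ 3 (3 * k) m ⟨
      3 + (3 * k ⊓ m)                   ≤⟨ ℕ.+-monoʳ-≤ 3 covers ⟩
      3 + ∣ N[ S ] pathGraph m ∣ˢ        ≤⟨ p⊆q⇒∣p∣≤∣q∣ shifted ⟩
      ∣ N[ S₊ ] pathGraph (3 + m) ∣ˢ    ∎)
    where
    open ℕ.≤-Reasoning
    S₊ = outside ∷ inside ∷ outside ∷ S
    -- The block ∘•∘ dominates its three vertices; the rest is P_m shifted by 3.
    shifted : inside ∷ inside ∷ inside ∷ N[ S ] pathGraph m ⊆ N[ S₊ ] pathGraph (3 + m)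
    shifted here                 = N-nbr {S = S₊} {pathGraph (3 + m)} (there here) _
    shifted (there here)         = N-self {S = S₊} {pathGraph (3 + m)} (there here)
    shifted (there (there here)) = N-nbr {S = S₊} {pathGraph (3 + m)} (there here) _
    shifted (there (there (there v∈N))) with N-elim {S = S} {pathGraph m} v∈N
    ... | inj₁ v∈S            = N-self {S = S₊} {pathGraph (3 + m)} (there (there (there v∈S)))
    ... | inj₂ (u , u∈S , uv) = N-nbr {S = S₊} {pathGraph (3 + m)} (there (there (there u∈S))) uv

  path-dominating-set : ∀ n k → k ≤ n → ∃ λ S → ∣ S ∣ˢ ≡ k × 3 * k ⊓ n ≤ ∣ N[ S ] pathGraph n ∣ˢ
  path-dominating-set n k k≤n with path-pattern n k
  ... | S , ∣S∣≤k , covers with extend S k ∣S∣≤k k≤n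
  ...   | S′ , S⊆S′ , ∣S′∣≡k =
    S′ , ∣S′∣≡k , ℕ.≤-trans covers (p⊆q⇒∣p∣≤∣q∣ (N-mono S⊆S′ ⊆ᴳ-refl))

module Bounds where
  open import Data.Nat as ℕ using (suc; _*_; _≤_)
  import Data.Nat.Properties as ℕ
  open import Data.Integer using (+_; -[1+_]; ∣_∣)
  open import Data.Rational using (mkℚ; 0ℚ; 1ℚ; _/_; ceiling; *<*)
    renaming (_≤_ to _≤ℚ_; _<_ to _<ℚ_; _*_ to _*ℚ_)
  open import Data.Fin.Subset using () renaming (∣_∣ to ∣_∣ˢ)
  open import Data.Fin.Subset.Properties using (⊆-refl; p⊆q⇒∣p∣≤∣q∣)
  open import Data.Product using (_,_; proj₁; proj₂)
  open import Relation.Binary.PropositionalEquality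
  open Arithmetic
  open Domination

  pd-between : ∀ n α → 0ℚ <ℚ α → α ≤ℚ 1ℚ →
               (G : Graph n) → pathGraph n ⊆ᴳ G → G ⊆ᴳ cycleGraph n →
               IsPd G α ∣ ceiling (α *ℚ (+ n / 3)) ∣
  pd-between n (mkℚ -[1+ _ ] _ _) (*<* ()) _
  pd-between n α@(mkℚ (+ a) e cop) _ α≤1 G P⊆G G⊆C = (S , dominating , ∣S∣≡k) , minimal
    where
    k = ∣ ceiling (α *ℚ (+ n / 3)) ∣
    αn   = scaled-fraction a e cop n 0
    αn/3 = scaled-fraction a e cop n 2
    open Threshold (numerator-≤-denominator α≤1)
                   (ceiling-fraction-upper αn/3) (ceiling-fraction-least αn/3)

    D·1≡D : ∀ c → c * (suc e * 1) ≡ c * suc e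
    D·1≡D c = cong (c *_) (ℕ.*-identityʳ (suc e))

    αn≤c⇒ : ∀ c → α *ℚ (+ n / 1) ≤ℚ (+ c / 1) → a * n ≤ c * suc e
    αn≤c⇒ c αn≤c = subst (a * n ≤_) (D·1≡D c) (fraction-≤-nat αn c αn≤c)

    αn≤c⇐ : ∀ c → a * n ≤ c * suc e → α *ℚ (+ n / 1) ≤ℚ (+ c / 1)
    αn≤c⇐ c an≤cD = fraction-≤-nat⁻ αn c (subst (a * n ≤_) (sym (D·1≡D c)) an≤cD)

    k-set = path-dominating-set n k k≤n
    S = proj₁ k-set
    ∣S∣≡k = proj₁ (proj₂ k-set)

    -- S dominates min(3k, n) vertices of P_n, hence of G.
    dominating : IsPartialDom G α S
    dominating = αn≤c⇐ ∣ N[ S ] G ∣ˢ (enough ∣ N[ S ] G ∣ˢ (ℕ.≤-trans (proj₂ (proj₂ k-set))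
      (p⊆q⇒∣p∣≤∣q∣ (N-mono {S = S} ⊆-refl P⊆G))))

    -- Any α-dominating S′ dominates at most 3|S′| vertices, so |S′| ≥ k.
    minimal : ∀ S′ → IsPartialDom G α S′ → k ≤ ∣ S′ ∣ˢ
    minimal S′ S′-dominating = lower ∣ N[ S′ ] G ∣ˢ ∣ S′ ∣ˢ
      (αn≤c⇒ ∣ N[ S′ ] G ∣ˢ S′-dominating) (∣N∣≤3∣S∣ G G⊆C S′)

open import Data.Nat using (ℕ; _≤_)
open import Data.Integer using (+_; ∣_∣)
open import Data.Rational using (ℚ; 0ℚ; 1ℚ; _/_; _*_; ceiling) renaming (_≤_ to _≤ℚ_; _<_ to _<ℚ_)
open import Data.Product using (_×_; _,_)
open Domination using (⊆ᴳ-refl; path⊆cycle)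
open Bounds using (pd-between)

mainTheorem3 : (n : ℕ) (α : ℚ) → 0ℚ <ℚ α → α ≤ℚ 1ℚ →
    IsPd (pathGraph n) α ∣ ⌈ α * (+ n / 3) ⌉ ∣
    × (3 ≤ n → IsPd (cycleGraph n) α ∣ ⌈ α * (+ n / 3) ⌉ ∣)
mainTheorem3 n α 0<α α≤1 =
  pd-between n α 0<α α≤1 (pathGraph n) ⊆ᴳ-refl path⊆cycle ,
  λ _ → pd-between n α 0<α α≤1 (cycleGraph n) path⊆cycle ⊆ᴳ-refl
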